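{- Let $G$ be a connected 2-outerplanar graph with a fixed 2-outerplanar embedding in which every face other than the infinite face is a triangle, and let $L_1,L_2$ be its layers. If $v\in L_2$ has between degree $1$, then $v$ is incident to exactly two edges of $\partial G[L_2]$.
   Context: All graphs are finite and simple. For a planar embedded graph $H$, $\partial H$ denotes the boundary of the infinite face of $H$; "edges of $\partial H$" are the edges on this boundary. A planar embedded graph is outerplanar if all vertices lie on the boundary of the infinite face, and 2-outerplanar if deleting the vertices on the boundary of the infinite face leaves an outerplanar graph. The layers are: $L_1$ = the set of vertices on $\partial G$, and $L_2=V(G)\setminus L_1$; $G[L_2]$ carries the embedding inherited from $G$. The between degree of a vertex $v\in L_i$ is the number of its neighbours in $L_j$, $j\ne i$. -}

module Defs where

open import Data.Nat using (ℕ; zero; suc; _+_; _*_; _≤ᵇ_)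
open import Data.Fin using (Fin; toℕ; _≟_)
open import Data.Bool using (Bool; true; false; _∨_; _∧_; not; if_then_else_)
open import Data.List using (List; allFin; map; foldr)
open import Data.Nat.ListAction using (sum)
open import Data.Product using (Σ; ∃; ∃-syntax; _×_; _,_)
open import Data.Sum using (_⊎_)
open import Relation.Nullary using (¬_; does)
open import Relation.Binary.PropositionalEquality using (_≡_; _≢_)
open import Function.Definitions using (Injective)

iter : {A : Set} → ℕ → (A → A) → A → A
iter zero    f x = x
iter (suc k) f x = f (iter k f x)

reachWithin : {d : ℕ} → ℕ → (Fin d → Fin d) → Fin d → Fin d → Bool
reachWithin zero    f x y = false
reachWithin (suc k) f x y = does (x ≟ y) ∨ reachWithin k f (f x) y

-- x is the representative (least index) of its f-orbit
isRep : {d : ℕ} → (Fin d → Fin d) → Fin d → Bool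
isRep {d} f x =
  foldr _∧_ true (map (λ y → not (reachWithin d f y x) ∨ (toℕ x ≤ᵇ toℕ y)) (allFin d))

numOrbits : {d : ℕ} → (Fin d → Fin d) → ℕ
numOrbits {d} f = sum (map (λ x → if isRep f x then 1 else 0) (allFin d))

-- Finite simple graphs with a planar embedding, given combinatorially
-- as a rotation system (combinatorial map) of genus 0, together with a
-- designated dart whose face is the infinite face.
--
-- Darts (= oriented edges): Fin d.
-- A dart x goes from tail x to head x = tail (rev x).
-- rot x is the next dart around the vertex tail x in the cyclic
-- (counter-clockwise) order.  The face to the left of x is traversed by
-- the face permutation φ = rot ∘ rev.

record PlaneGraph : Set where
  field
    n    : ℕ
    d    : ℕ
    tail : Fin d → Fin n
    rev  : Fin d → Fin d
    rot  : Fin d → Fin d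
    -- rev is a fixed-point-free involution (each edge = pair of darts)
    rev-invol : ∀ x → rev (rev x) ≡ x
    rev-nofix : ∀ x → rev x ≢ x
    rot-inj   : Injective _≡_ _≡_ rot
    rot-tail  : ∀ x → tail (rot x) ≡ tail x
    rot-trans : ∀ x y → tail x ≡ tail y → ∃[ k ] iter k rot x ≡ y
    noLoop    : ∀ x → tail (rev x) ≢ tail x
    noMulti   : ∀ x y → tail x ≡ tail y → tail (rev x) ≡ tail (rev y) → x ≡ y
    -- planarity (genus 0): Euler's formula 2(V + F) = (#darts) + 4,
    -- i.e. V - E + F = 2 (for connected graphs)
    euler     : 2 * (n + numOrbits (λ x → rot (rev x))) ≡ d + 4
    outer     : Fin d

module _ (G : PlaneGraph) where
  open PlaneGraph G

  Vertex : Set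
  Vertex = Fin n

  Dart : Set
  Dart = Fin d

  head : Dart → Vertex
  head x = tail (rev x)

  φ : Dart → Dart
  φ x = rot (rev x)

  InOuterFace : Dart → Set
  InOuterFace x = ∃[ k ] iter k φ outer ≡ x

  data Walk : Vertex → Vertex → Set where
    here : ∀ {u} → Walk u u
    step : ∀ {v} (x : Dart) → Walk (head x) v → Walk (tail x) v

  Connected : Set
  Connected = ∀ u v → Walk u v

  InnerTriangulated : Set
  InnerTriangulated =
    ∀ x → ¬ InOuterFace x → (iter 3 φ x ≡ x) × (φ x ≢ x)

  L1 : Vertex → Set
  L1 v = ∃[ x ] (tail x ≡ v × InOuterFace x)

  L2 : Vertex → Set
  L2 v = ¬ L1 v

  L2Dart : Dart → Set
  L2Dart x = L2 (tail x) × L2 (head x)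

  -- the face of G[L2] (with the inherited embedding) containing the
  -- left side of dart x is the infinite face of G[L2]:  the faces of
  -- G[L2] are unions of faces of G glued across the deleted edges, and
  -- the infinite face of G[L2] is the one containing the infinite face
  -- of G.
  data InOuterFaceL2 : Dart → Set where
    base  : InOuterFaceL2 outer
    face  : ∀ {x} → InOuterFaceL2 x → InOuterFaceL2 (φ x)
    cross : ∀ {x} → InOuterFaceL2 x → ¬ L2Dart x → InOuterFaceL2 (rev x)

  -- G is 2-outerplanar (w.r.t. the given embedding): G[L2] is outerplanar,
  -- i.e. every vertex of L2 lies on the boundary of the infinite face of
  -- G[L2] (some corner of v belongs to that face).
  TwoOuterplanar : Set
  TwoOuterplanar = ∀ v → L2 v → ∃[ x ] (tail x ≡ v × InOuterFaceL2 x)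

  BoundaryEdgeL2 : Dart → Set
  BoundaryEdgeL2 x = L2Dart x × (InOuterFaceL2 x ⊎ InOuterFaceL2 (rev x))

  -- v (in L2) has between degree 1: exactly one neighbour in L1
  -- (neighbours of v correspond bijectively to darts with tail v)
  BetweenDegreeOne : Vertex → Set
  BetweenDegreeOne v =
    ∃[ x ] ((tail x ≡ v × L1 (head x)) ×
            (∀ y → tail y ≡ v → L1 (head y) → y ≡ x))

  -- v is incident to exactly two edges of ∂ G[L2]
  -- (edges at v correspond bijectively to darts with tail v)
  ExactlyTwoBoundaryEdgesL2 : Vertex → Set
  ExactlyTwoBoundaryEdgesL2 v =
    Σ Dart λ x → Σ Dart λ y →
      (x ≢ y) ×
      (tail x ≡ v × BoundaryEdgeL2 x) ×
      (tail y ≡ v × BoundaryEdgeL2 y) ×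
      (∀ z → tail z ≡ v → BoundaryEdgeL2 z → (z ≡ x ⊎ z ≡ y))

module Submission where

-- Let v ∈ L₂ have between degree one, realised by the dart a from v to u ∈ L₁.
-- Every dart at a vertex of L₁ lies in the infinite face of G[L₂]: rotating
-- around u means crossing edges that are not in G[L₂].  Hence a, rev a and
-- rot a lie in that face, and the triangle at a shows that the rotation
-- predecessor p of a is traversed backwards by it too.  So the edges rot a
-- and p (both in G[L₂], since a is the only dart at v leaving L₂) are edges
-- of ∂G[L₂].  Any further boundary edge z at v would put a triangle of G with
-- all three corners in L₂ into the infinite face of G[L₂], which is
-- impossible because that face is reached from the infinite face of G only
-- through edges touching L₁.  This needs deg v ≥ 3, so that rot a ≠ p:
-- degree one would force a loop, and degree two would make G (being
-- connected) a single triangle, putting v on ∂G.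

open import Defs
open import Data.Nat using (zero; suc)
open import Data.Fin using (_≟_)
open import Data.Product using (∃-syntax; _×_; _,_; proj₁; proj₂)
open import Data.Sum using (_⊎_; inj₁; inj₂)
open import Data.Empty using (⊥; ⊥-elim)
open import Relation.Nullary using (¬_; yes; no)
open import Relation.Binary.PropositionalEquality

iter-shift : ∀ {A : Set} k (f : A → A) x → iter k f (f x) ≡ f (iter k f x)
iter-shift zero    f x = refl
iter-shift (suc k) f x = cong f (iter-shift k f x)

module PlaneGraphFacts (G : PlaneGraph) where
  open PlaneGraph G

  rev-inj : ∀ {x y} → rev x ≡ rev y → x ≡ y
  rev-inj {x} {y} e = trans (sym (rev-invol x)) (trans (cong rev e) (rev-invol y))

  φ-inj : ∀ {x y} → φ G x ≡ φ G y → x ≡ y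
  φ-inj e = rev-inj (rot-inj e)

  tail-φ : ∀ x → tail (φ G x) ≡ head G x
  tail-φ x = rot-tail (rev x)

  φ-rev : ∀ x → φ G (rev x) ≡ rot x
  φ-rev x = cong rot (rev-invol x)

  rot-pred : ∀ z → ∃[ p ] rot p ≡ z
  rot-pred z with rot-trans (rot z) z (rot-tail z)
  ... | k , e = iter k rot z , trans (sym (iter-shift k rot z)) e

  around-vertex : (P : Dart G → Set) → (∀ z → P z → P (rot z)) →
    ∀ {b z} → P b → tail z ≡ tail b → P z
  around-vertex P rot-closed {b} {z} Pb tz with rot-trans b z (sym tz)
  ... | k , e = subst P e (iterate k Pb)
    where
    iterate : ∀ k {x} → P x → P (iter k rot x)
    iterate zero    Px = Px
    iterate (suc k) Px = rot-closed _ (iterate k Px)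

  triangle-corner : ∀ {p z} → rot p ≡ z → iter 3 (φ G) z ≡ z → φ G (φ G z) ≡ rev p
  triangle-corner rp closes =
    trans (sym (rev-invol _)) (cong rev (rot-inj (trans closes (sym rp))))

  -- A vertex of degree one is not a corner of a triangular face:
  -- the face would use the loop from head a to itself.
  degree-one-no-triangle : ∀ {a} → rot a ≡ a → iter 3 (φ G) a ≡ a → ⊥
  degree-one-no-triangle {a} loop closes = noLoop (φ G a) (begin
    head G (φ G a)            ≡⟨ sym (tail-φ (φ G a)) ⟩
    tail (φ G (φ G a))        ≡⟨ cong tail (triangle-corner loop closes) ⟩
    tail (rev a)              ≡⟨ sym (tail-φ a) ⟩
    tail (φ G a)              ∎)
    where open ≡-Reasoning

  closed-set-is-everything : Connected G → (P : Dart G → Set) →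
    (∀ z → P z → P (rev z)) → (∀ z → P z → P (φ G z)) →
    ∀ {c} → P c → ∀ y → P y
  closed-set-is-everything connected P rev-closed φ-closed {c} Pc y =
    at-y (along (connected (tail c) (tail y)) (c , refl , Pc))
    where
    rot-closed : ∀ z → P z → P (rot z)
    rot-closed z Pz = subst P (φ-rev z) (φ-closed (rev z) (rev-closed z Pz))

    Meets : Vertex G → Set
    Meets s = ∃[ x ] (tail x ≡ s × P x)

    along : ∀ {s t} → Walk G s t → Meets s → Meets t
    along here m = m
    along (step x w) (x′ , tx′ , Px′) =
      along w (rev x , refl , rev-closed x (around-vertex P rot-closed Px′ (sym tx′)))

    at-y : Meets (tail y) → P y
    at-y (x , tx , Px) = around-vertex P rot-closed Px (sym tx)

  OnTriangle : Dart G → Dart G → Set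
  OnTriangle c z = z ≡ c ⊎ z ≡ φ G c ⊎ z ≡ φ G (φ G c)

  on-triangle-φ : ∀ {c z} → iter 3 (φ G) c ≡ c → OnTriangle c z → OnTriangle c (φ G z)
  on-triangle-φ closes (inj₁ e)        = inj₂ (inj₁ (cong (φ G) e))
  on-triangle-φ closes (inj₂ (inj₁ e)) = inj₂ (inj₂ (cong (φ G) e))
  on-triangle-φ closes (inj₂ (inj₂ e)) = inj₁ (trans (cong (φ G) e) closes)

  on-triangle-returns : ∀ {c z} → iter 3 (φ G) c ≡ c → OnTriangle c z → ∃[ k ] iter k (φ G) z ≡ c
  on-triangle-returns closes (inj₁ e)        = 0 , e
  on-triangle-returns closes (inj₂ (inj₁ e)) = 2 , trans (cong (iter 2 (φ G)) e) closes
  on-triangle-returns closes (inj₂ (inj₂ e)) = 1 , trans (cong (φ G) e) closes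

  rev-on-triangle : ∀ {c c′} → φ G (φ G c) ≡ rev c′ → φ G (φ G c′) ≡ rev c →
    rev (φ G c) ≡ φ G c′ → ∀ {z} → OnTriangle c z → OnTriangle c′ (rev z)
  rev-on-triangle _ corner′ _ (inj₁ e) =
    inj₂ (inj₂ (trans (cong rev e) (sym corner′)))
  rev-on-triangle _ _ shared (inj₂ (inj₁ e)) = inj₂ (inj₁ (trans (cong rev e) shared))
  rev-on-triangle {c′ = c′} corner _ _ (inj₂ (inj₂ e)) =
    inj₁ (trans (cong rev (trans e corner)) (rev-invol c′))

  -- In a connected graph, a vertex of degree at most two whose faces are
  -- triangles lies on the infinite face: the two triangles are all of G.
  degree-two-outer : Connected G → ∀ {a} → rot (rot a) ≡ a →
    iter 3 (φ G) a ≡ a → iter 3 (φ G) (rot a) ≡ rot a → L1 G (tail a)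
  degree-two-outer connected {a} rot²a closes-a closes-b =
    outer-on-either (closed-set-is-everything connected OnEither rev-closed φ-closed
                       (inj₁ (inj₁ refl)) outer)
    where
    b : Dart G
    b = rot a

    corner-a : φ G (φ G a) ≡ rev b
    corner-a = triangle-corner rot²a closes-a

    corner-b : φ G (φ G b) ≡ rev a
    corner-b = triangle-corner refl closes-b

    -- the third sides of both triangles form one edge, as G is simple
    shared : rev (φ G a) ≡ φ G b
    shared = noMulti (rev (φ G a)) (φ G b)
      (begin
        tail (rev (φ G a))       ≡⟨ sym (tail-φ (φ G a)) ⟩
        tail (φ G (φ G a))       ≡⟨ cong tail corner-a ⟩
        tail (rev b)             ≡⟨ sym (tail-φ b) ⟩
        tail (φ G b)             ∎)
      (begin
        tail (rev (rev (φ G a))) ≡⟨ cong tail (rev-invol (φ G a)) ⟩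
        tail (φ G a)             ≡⟨ tail-φ a ⟩
        tail (rev a)             ≡⟨ cong tail (sym corner-b) ⟩
        tail (φ G (φ G b))       ≡⟨ tail-φ (φ G b) ⟩
        tail (rev (φ G b))       ∎)
      where open ≡-Reasoning

    shared′ : rev (φ G b) ≡ φ G a
    shared′ = trans (cong rev (sym shared)) (rev-invol (φ G a))

    OnEither : Dart G → Set
    OnEither z = OnTriangle a z ⊎ OnTriangle b z

    rev-closed : ∀ z → OnEither z → OnEither (rev z)
    rev-closed z (inj₁ t) = inj₂ (rev-on-triangle corner-a corner-b shared t)
    rev-closed z (inj₂ t) = inj₁ (rev-on-triangle corner-b corner-a shared′ t)

    φ-closed : ∀ z → OnEither z → OnEither (φ G z)
    φ-closed z (inj₁ t) = inj₁ (on-triangle-φ closes-a t)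
    φ-closed z (inj₂ t) = inj₂ (on-triangle-φ closes-b t)

    -- the infinite face is one of the two triangles, both having v as a corner
    outer-on-either : OnEither outer → L1 G (tail a)
    outer-on-either (inj₁ t) = a , refl , on-triangle-returns closes-a t
    outer-on-either (inj₂ t) = b , rot-tail a , on-triangle-returns closes-b t

  -- Every dart at a vertex of L₁ lies in the infinite face of G[L₂]: going
  -- around such a vertex only crosses edges that are not in G[L₂].
  L1-darts-outerL2 : ∀ {u} → L1 G u → ∀ z → tail z ≡ u → InOuterFaceL2 G z
  L1-darts-outerL2 {u} u∈L1@(x , tx , k , e) z tz =
    around-vertex AtU next {x} (λ _ → subst (InOuterFaceL2 G) e (orbit k)) (trans tz (sym tx)) tz
    where
    AtU : Dart G → Set
    AtU z = tail z ≡ u → InOuterFaceL2 G z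

    next : ∀ z → AtU z → AtU (rot z)
    next z atU trz = subst (InOuterFaceL2 G) (φ-rev z)
      (face (cross (atU tz′) (λ zL2 → proj₁ zL2 (subst (L1 G) (sym tz′) u∈L1))))
      where
      tz′ : tail z ≡ u
      tz′ = trans (sym (rot-tail z)) trz

    orbit : ∀ k → InOuterFaceL2 G (iter k (φ G) outer)
    orbit zero    = base
    orbit (suc k) = face (orbit k)

  -- A triangle of G with all corners in L₂ is not in the infinite face of
  -- G[L₂]: that face is entered from the infinite face of G only across
  -- edges with an end in L₁, which the triangle does not have.
  L2-triangle-inner : ∀ {y} → InOuterFaceL2 G y → iter 3 (φ G) y ≡ y →
    L2 G (tail y) → L2 G (tail (φ G y)) → L2 G (tail (φ G (φ G y))) → ⊥
  L2-triangle-inner base _ outer∈L2 _ _ = outer∈L2 (outer , refl , 0 , refl)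
  L2-triangle-inner (face {x} r) closes y∈L2 φy∈L2 φφy∈L2 =
    L2-triangle-inner r closes-x (subst (λ t → L2 G (tail t)) closes-x φφy∈L2) y∈L2 φy∈L2
    where
    closes-x : iter 3 (φ G) x ≡ x
    closes-x = φ-inj closes
  L2-triangle-inner (cross {x} _ x∉L2) _ y∈L2 φy∈L2 _ =
    x∉L2 (subst (L2 G) (trans (rot-tail (rev (rev x))) (cong tail (rev-invol x))) φy∈L2 , y∈L2)

module BetweenDegreeOneVertex (G : PlaneGraph) (triangulated : InnerTriangulated G)
  {v : Vertex G} (v∈L2 : L2 G v) (a : Dart G) (tail-a : PlaneGraph.tail G a ≡ v)
  (head-a∈L1 : L1 G (head G a))
  (a-unique : ∀ y → PlaneGraph.tail G y ≡ v → L1 G (head G y) → y ≡ a) where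
  open PlaneGraph G
  open PlaneGraphFacts G

  -- all faces at v are triangles, since v is not on the infinite face
  triangle-at-v : ∀ {z} → tail z ≡ v → iter 3 (φ G) z ≡ z
  triangle-at-v {z} tz = proj₁ (triangulated z (λ z∈outer → v∈L2 (z , tz , z∈outer)))

  other-neighbour-L2 : ∀ {z} → tail z ≡ v → z ≢ a → L2 G (head G z)
  other-neighbour-L2 {z} tz z≢a head∈L1 = z≢a (a-unique z tz head∈L1)

  -- a triangle at v whose other corners are in L₂ is not in the infinite
  -- face of G[L₂]; the corners of the face of z are v, head z and head p
  inner-corner : ∀ {p z} → rot p ≡ z → tail z ≡ v →
    L2 G (head G z) → L2 G (head G p) → ¬ InOuterFaceL2 G z
  inner-corner {p} {z} rp tz z∈L2 p∈L2 z∈outer =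
    L2-triangle-inner z∈outer closes (subst (L2 G) (sym tz) v∈L2)
      (subst (L2 G) (sym (tail-φ z)) z∈L2)
      (subst (λ t → L2 G (tail t)) (sym (triangle-corner rp closes)) p∈L2)
    where
    closes : iter 3 (φ G) z ≡ z
    closes = triangle-at-v tz

  p : Dart G
  p = proj₁ (rot-pred a)

  rot-p : rot p ≡ a
  rot-p = proj₂ (rot-pred a)

  tail-p : tail p ≡ v
  tail-p = trans (sym (rot-tail p)) (trans (cong tail rot-p) tail-a)

  tail-L2 : ∀ {z} → tail z ≡ v → L2 G (tail z)
  tail-L2 tz = subst (L2 G) (sym tz) v∈L2

  -- the edge a leads to L₁, so both its sides, and the next dart rot a,
  -- lie in the infinite face of G[L₂]
  rev-a-outer : InOuterFaceL2 G (rev a)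
  rev-a-outer = L1-darts-outerL2 head-a∈L1 (rev a) refl

  a-outer : InOuterFaceL2 G a
  a-outer = subst (InOuterFaceL2 G) (rev-invol a)
    (cross rev-a-outer (λ revaL2 → proj₁ revaL2 head-a∈L1))

  rot-a-outer : InOuterFaceL2 G (rot a)
  rot-a-outer = subst (InOuterFaceL2 G) (φ-rev a) (face rev-a-outer)

  -- the triangle of a returns to v along rev p
  rev-p-outer : InOuterFaceL2 G (rev p)
  rev-p-outer = subst (InOuterFaceL2 G) (triangle-corner rot-p (triangle-at-v tail-a))
    (face (face a-outer))

  rot-a-boundary : rot a ≢ a → BoundaryEdgeL2 G (rot a)
  rot-a-boundary rota≢a = (tail-L2 tail-rot-a , other-neighbour-L2 tail-rot-a rota≢a) ,
                          inj₁ rot-a-outer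
    where
    tail-rot-a : tail (rot a) ≡ v
    tail-rot-a = trans (rot-tail a) tail-a

  p-boundary : p ≢ a → BoundaryEdgeL2 G p
  p-boundary p≢a = (tail-L2 tail-p , other-neighbour-L2 tail-p p≢a) , inj₂ rev-p-outer

  only-boundary : ∀ z → tail z ≡ v → BoundaryEdgeL2 G z → z ≡ rot a ⊎ z ≡ p
  only-boundary z tz ((_ , head-z∈L2) , inj₁ z-outer) with z ≟ rot a
  ... | yes z≡rot-a = inj₁ z≡rot-a
  ... | no  z≢rot-a = ⊥-elim (inner-corner rot-q tz head-z∈L2 head-q∈L2 z-outer)
    where
    q : Dart G
    q = proj₁ (rot-pred z)

    rot-q : rot q ≡ z
    rot-q = proj₂ (rot-pred z)

    head-q∈L2 : L2 G (head G q)
    head-q∈L2 = other-neighbour-L2 (trans (sym (rot-tail q)) (trans (cong tail rot-q) tz))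
                  (λ q≡a → z≢rot-a (trans (sym rot-q) (cong rot q≡a)))
  only-boundary z tz ((_ , head-z∈L2) , inj₂ rev-z-outer) with z ≟ p
  ... | yes z≡p = inj₂ z≡p
  ... | no  z≢p = ⊥-elim (inner-corner refl tail-rot-z
                    (other-neighbour-L2 tail-rot-z (λ rotz≡a → z≢p (rot-inj (trans rotz≡a (sym rot-p)))))
                    head-z∈L2
                    (subst (InOuterFaceL2 G) (φ-rev z) (face rev-z-outer)))
    where
    tail-rot-z : tail (rot z) ≡ v
    tail-rot-z = trans (rot-tail z) tz

  exactly-two : rot a ≢ a → rot (rot a) ≢ a → ExactlyTwoBoundaryEdgesL2 G v
  exactly-two rota≢a rot²a≢a =
    rot a , p , rot-a≢p ,
    (trans (rot-tail a) tail-a , rot-a-boundary rota≢a) ,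
    (tail-p , p-boundary (λ p≡a → rota≢a (trans (cong rot (sym p≡a)) rot-p))) ,
    only-boundary
    where
    rot-a≢p : rot a ≢ p
    rot-a≢p rota≡p = rot²a≢a (trans (cong rot rota≡p) rot-p)

  -- v has degree at least three: degree one gives a loop, degree two puts
  -- v on ∂G; so the two boundary edges above exist
  two-boundary-edges : Connected G → ExactlyTwoBoundaryEdgesL2 G v
  two-boundary-edges connected with rot a ≟ a | rot (rot a) ≟ a
  ... | yes rota≡a | _ = ⊥-elim (degree-one-no-triangle rota≡a (triangle-at-v tail-a))
  ... | no _ | yes rot²a≡a = ⊥-elim (v∈L2 (subst (L1 G) tail-a
          (degree-two-outer connected rot²a≡a (triangle-at-v tail-a)
             (triangle-at-v (trans (rot-tail a) tail-a)))))
  ... | no rota≢a | no rot²a≢a = exactly-two rota≢a rot²a≢a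

-- A vertex of L₂ with between degree one, realised by the dart a, is
-- incident to exactly two edges of ∂G[L₂].
lemma1 : (G : PlaneGraph) → Connected G → InnerTriangulated G → TwoOuterplanar G →
    (v : Vertex G) → L2 G v → BetweenDegreeOne G v → ExactlyTwoBoundaryEdgesL2 G v
lemma1 G connected triangulated _ v v∈L2 (a , (tail-a , head-a∈L1) , a-unique) =
  BetweenDegreeOneVertex.two-boundary-edges G triangulated v∈L2 a tail-a head-a∈L1 a-unique
    connected
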